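{- Let $S\subseteq\mathbb{F}_q^*$ be $k$ algebraically nice, and let $S_0,S_1\subseteq\mathbb{F}_q$ be sets witnessing this (so $S_0\ne\emptyset$, $|S_1|=k'$ odd with $k'\le k$, and $|S_0\cap(\alpha+\beta S_1)|$ is even for all $\alpha\in\mathbb{F}_q$, $\beta\in S$). Then there exists a set $S_0'\subseteq\mathbb{F}_q$ with $|S_0'|\ge\lceil q/2\rceil$ such that $|S_0'\cap(\alpha+\beta S_1)|$ is even for all $\alpha\in\mathbb{F}_q$ and $\beta\in S$ (i.e., $S_0$ can be redefined to satisfy $|S_0|\ge\lceil q/2\rceil$).
   Context: $\mathbb{F}_q$ is the finite field with $q$ elements and $\mathbb{F}_q^*$ its multiplicative group. For $S_1\subseteq\mathbb{F}_q$ and $\alpha,\beta\in\mathbb{F}_q$, $\alpha+\beta S_1=\{\alpha+\beta s:s\in S_1\}$. A set $S\subseteq\mathbb{F}_q^*$ is called $k$ algebraically nice if $k$ is odd and there exist an odd $k'\le k$ and sets $S_0,S_1\subseteq\mathbb{F}_q$ such that $S_0\neq\emptyset$, $|S_1|=k'$, and for all $\alpha\in\mathbb{F}_q$ and $\beta\in S$ the number $|S_0\cap(\alpha+\beta S_1)|$ is even. -}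

module Defs where

open import Data.Nat using (ℕ; _≤_)
open import Data.Nat.Divisibility using (_∣_)
open import Data.Fin using (Fin)
import Data.Fin as Fin
open import Data.Bool using (Bool; true; false; _∧_; if_then_else_)
open import Data.List using (List; map; allFin)
open import Data.Nat.ListAction using (sum)
open import Data.Bool.ListAction using (any)
open import Data.Product using (Σ; ∃; _×_)
open import Relation.Nullary using (¬_)
open import Relation.Nullary.Decidable using (⌊_⌋)
open import Relation.Binary.PropositionalEquality using (_≡_; _≢_)
open import Function.Bundles using (_↔_; Inverse)
open import Algebra.Structures using (IsCommutativeRing)

record FiniteField : Set₁ where
  infixl 6 _+_
  infixl 7 _*_
  field
    Carrier : Set
    q       : ℕ
    enum    : Carrier ↔ Fin q
    _+_ _*_ : Carrier → Carrier → Carrier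
    -_      : Carrier → Carrier
    0# 1#   : Carrier
    isCommutativeRing : IsCommutativeRing _≡_ _+_ _*_ -_ 0# 1#
    0≢1     : 0# ≢ 1#
    inverse : ∀ x → x ≢ 0# → ∃ λ y → x * y ≡ 1#

  elem : Fin q → Carrier
  elem = Inverse.from enum

  elements : List Carrier
  elements = map elem (allFin q)

  _==_ : Carrier → Carrier → Bool
  x == y = ⌊ Inverse.to enum x Fin.≟ Inverse.to enum y ⌋

  FSubset : Set
  FSubset = Carrier → Bool

  card : FSubset → ℕ
  card A = sum (map (λ x → if A x then 1 else 0) elements)

  _∩_ : FSubset → FSubset → FSubset
  (A ∩ B) x = A x ∧ B x

  affine : Carrier → Carrier → FSubset → FSubset
  affine α β S₁ x = any (λ s → S₁ s ∧ (x == (α + β * s))) elements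

  Nonempty : FSubset → Set
  Nonempty A = ∃ λ x → A x ≡ true

  SubsetOfUnits : FSubset → Set
  SubsetOfUnits S = ∀ β → S β ≡ true → β ≢ 0#

  Even Odd : ℕ → Set
  Even n = 2 ∣ n
  Odd n = ¬ (2 ∣ n)

  ParityCondition : FSubset → FSubset → FSubset → Set
  ParityCondition S S₀ S₁ =
    ∀ α β → S β ≡ true → Even (card (S₀ ∩ affine α β S₁))

  NiceWitness : ℕ → FSubset → ℕ → FSubset → FSubset → Set
  NiceWitness k S k' S₀ S₁ =
    Odd k × Odd k' × k' ≤ k × Nonempty S₀ × card S₁ ≡ k' × ParityCondition S S₀ S₁

  AlgebraicallyNice : ℕ → FSubset → Set
  AlgebraicallyNice k S =
    Odd k × Σ ℕ λ k' → Σ FSubset λ S₀ → Σ FSubset λ S₁ → NiceWitness k S k' S₀ S₁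

-- If T satisfies the parity condition, so does every translate T + γ (the family of
-- lines α + β S₁ is translation invariant) and hence so does the symmetric difference
-- T Δ (T + γ). Double counting gives  Σ_γ |T Δ (T + γ)| + 2|T|² = 2q|T|,  so if no γ
-- makes T Δ (T + γ) larger than T, then q|T| + 2|T|² ≥ 2q|T|, i.e. |T| ≥ q/2.
-- Otherwise replace T by the larger set T Δ (T + γ); the size is bounded by q, so
-- starting from S₀ this terminates.
module Submission where

open import Defs
open import Data.Nat using (ℕ; _≤_; ⌈_/2⌉)
open import Data.Product using (Σ; _×_)

open import Data.Nat using (zero; suc; _+_; _*_; _<_; _≤?_; z≤n; NonZero; >-nonZero)
open import Data.Nat.Properties
open import Data.Nat.Divisibility using (∣m+n∣m⇒∣n; ∣m∣n⇒∣m+n; m∣m*n)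
open import Data.Nat.ListAction using (sum)
open import Data.Product using (∃; _,_)
open import Data.Sum using (_⊎_; inj₁; inj₂)
open import Data.Bool using (Bool; true; false; _∧_; _xor_; if_then_else_)
open import Data.Bool.Properties using (∧-distribʳ-xor)
open import Data.Bool.ListAction using (or)
open import Data.List using (map; tabulate)
open import Data.List.Properties using (map-cong; map-tabulate)
open import Data.Fin using (Fin)
import Data.Fin as Fin
import Data.Fin.Properties as Fin
open import Data.Vec.Functional using (Vector)
import Algebra.Properties.Semiring.Sum as SemiringSum
open import Algebra.Bundles using (Group)
import Algebra.Properties.Group as GroupProperties
open import Algebra.Structures using (IsCommutativeRing)
open import Function using (_∘_; _↔_; Inverse; mk↔ₛ′; Injection; mk⇔)
open import Function.Construct.Composition using (_↔-∘_)
open import Function.Construct.Symmetry using (↔-sym)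
open import Function.Properties.Inverse using (↔⇒↣)
open import Relation.Nullary using (yes; no; does)
open import Relation.Nullary.Decidable using (isYes; isYes≗does; does-⇔)
open import Relation.Binary.PropositionalEquality

module V = SemiringSum +-*-semiring

sum-tabulate : ∀ {n} (f : Vector ℕ n) → sum (tabulate f) ≡ V.sum f
sum-tabulate {zero}  f = refl
sum-tabulate {suc n} f = cong (f Fin.zero +_) (sum-tabulate (f ∘ Fin.suc))

sum-const : ∀ n c → V.sum {n} (λ _ → c) ≡ n * c
sum-const zero    c = refl
sum-const (suc n) c = cong (c +_) (sum-const n c)

sum-mono-≤ : ∀ {n} {f g : Vector ℕ n} → (∀ i → f i ≤ g i) → V.sum f ≤ V.sum g
sum-mono-≤ {zero}  f≤g = z≤n
sum-mono-≤ {suc n} f≤g = +-mono-≤ (f≤g Fin.zero) (sum-mono-≤ (f≤g ∘ Fin.suc))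

lookup≤sum : ∀ {n} (f : Vector ℕ n) i → f i ≤ V.sum f
lookup≤sum f Fin.zero    = m≤m+n (f Fin.zero) _
lookup≤sum f (Fin.suc i) = ≤-trans (lookup≤sum (f ∘ Fin.suc) i) (m≤n+m _ (f Fin.zero))

𝟙 : Bool → ℕ
𝟙 b = if b then 1 else 0

𝟙-∧ : ∀ a b → 𝟙 (a ∧ b) ≡ 𝟙 a * 𝟙 b
𝟙-∧ true  b = sym (+-identityʳ (𝟙 b))
𝟙-∧ false b = refl

𝟙-xor : ∀ a b → 2 * 𝟙 (a ∧ b) + 𝟙 (a xor b) ≡ 𝟙 a + 𝟙 b
𝟙-xor true  true  = refl
𝟙-xor true  false = refl
𝟙-xor false true  = refl
𝟙-xor false false = refl

averaging : ∀ q t X .{{_ : NonZero t}} →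
  X ≤ q * t → 2 * (t * t) + X ≡ q * (t + t) → q ≤ t + t
averaging q t X X≤qt total = *-cancelʳ-≤ q (t + t) t (+-cancelʳ-≤ (q * t) (q * t) ((t + t) * t) (begin
  q * t + q * t          ≡⟨ *-distribˡ-+ q t t ⟨
  q * (t + t)            ≡⟨ total ⟨
  2 * (t * t) + X        ≤⟨ +-monoʳ-≤ (2 * (t * t)) X≤qt ⟩
  2 * (t * t) + q * t    ≡⟨ cong (_+ q * t) (trans (cong ((_* t) ∘ (t +_)) (sym (+-identityʳ t))) (*-assoc 2 t t)) ⟨
  (t + t) * t + q * t    ∎))
  where open ≤-Reasoning

module ParitySets (F : FiniteField) where
  open FiniteField F renaming (_+_ to _+ᶠ_; _*_ to _*ᶠ_; -_ to -ᶠ_)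
  open IsCommutativeRing isCommutativeRing using (+-isGroup)
    renaming (+-comm to +ᶠ-comm; +-assoc to +ᶠ-assoc)

  +ᶠ-group : Group _ _
  +ᶠ-group = record { isGroup = +-isGroup }

  open GroupProperties +ᶠ-group using (//-rightDividesˡ; //-rightDividesʳ)

  toE : Carrier → Fin q
  toE = Inverse.to enum

  elem∘toE : ∀ x → elem (toE x) ≡ x
  elem∘toE = Inverse.strictlyInverseʳ enum

  translation : Carrier → Carrier ↔ Carrier
  translation γ = mk↔ₛ′ (_+ᶠ γ) (_+ᶠ -ᶠ γ) (//-rightDividesˡ γ) (//-rightDividesʳ γ)

  ∑ : (Carrier → ℕ) → ℕ
  ∑ h = sum (map h elements)

  ∑≡sum : ∀ h → ∑ h ≡ V.sum (h ∘ elem)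
  ∑≡sum h = begin
    sum (map h (map elem (tabulate (λ i → i))))  ≡⟨ cong (sum ∘ map h) (map-tabulate (λ i → i) elem) ⟩
    sum (map h (tabulate elem))                  ≡⟨ cong sum (map-tabulate elem h) ⟩
    sum (tabulate (h ∘ elem))                    ≡⟨ sum-tabulate (h ∘ elem) ⟩
    V.sum (h ∘ elem)                             ∎
    where open ≡-Reasoning

  ∑-cong : ∀ {f g} → (∀ x → f x ≡ g x) → ∑ f ≡ ∑ g
  ∑-cong f≗g = cong sum (map-cong f≗g elements)

  ∑-distrib-+ : ∀ f g → ∑ (λ x → f x + g x) ≡ ∑ f + ∑ g
  ∑-distrib-+ f g = trans (∑≡sum _) (trans (V.∑-distrib-+ (f ∘ elem) (g ∘ elem))
                      (sym (cong₂ _+_ (∑≡sum f) (∑≡sum g))))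

  ∑-*ˡ : ∀ c f → ∑ (λ x → c * f x) ≡ c * ∑ f
  ∑-*ˡ c f = trans (∑≡sum _) (sym (trans (cong (c *_) (∑≡sum f)) (V.*-distribˡ-sum c (f ∘ elem))))

  ∑-const : ∀ c → ∑ (λ _ → c) ≡ q * c
  ∑-const c = trans (∑≡sum _) (sum-const q c)

  ∑-comm : ∀ (f : Carrier → Carrier → ℕ) → ∑ (λ x → ∑ (f x)) ≡ ∑ (λ y → ∑ (λ x → f x y))
  ∑-comm f = begin
    ∑ (λ x → ∑ (f x))                              ≡⟨ ∑≡sum _ ⟩
    V.sum (λ i → ∑ (f (elem i)))                   ≡⟨ V.sum-cong-≗ (λ i → ∑≡sum (f (elem i))) ⟩
    V.sum (λ i → V.sum (λ j → f (elem i) (elem j))) ≡⟨ V.∑-comm (λ i j → f (elem i) (elem j)) ⟩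
    V.sum (λ j → V.sum (λ i → f (elem i) (elem j))) ≡⟨ V.sum-cong-≗ (λ j → ∑≡sum (λ x → f x (elem j))) ⟨
    V.sum (λ j → ∑ (λ x → f x (elem j)))           ≡⟨ ∑≡sum _ ⟨
    ∑ (λ y → ∑ (λ x → f x y))                      ∎
    where open ≡-Reasoning

  ∑-bijection : (τ : Carrier ↔ Carrier) (h : Carrier → ℕ) → ∑ (h ∘ Inverse.to τ) ≡ ∑ h
  ∑-bijection τ h = begin
    ∑ (h ∘ Inverse.to τ)                          ≡⟨ ∑≡sum _ ⟩
    V.sum (h ∘ Inverse.to τ ∘ elem)               ≡⟨ V.sum-cong-≗ {q} (λ i → cong h (elem∘toE (Inverse.to τ (elem i)))) ⟨
    V.sum (λ i → h (elem (Inverse.to π i)))       ≡⟨ V.sum-permute (h ∘ elem) π ⟨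
    V.sum (h ∘ elem)                              ≡⟨ ∑≡sum h ⟨
    ∑ h                                           ∎
    where
    open ≡-Reasoning
    π : Fin q ↔ Fin q
    π = enum ↔-∘ (τ ↔-∘ ↔-sym enum)

  ∑-translate : ∀ γ h → ∑ (λ x → h (x +ᶠ γ)) ≡ ∑ h
  ∑-translate γ = ∑-bijection (translation γ)

  ∑-mono-≤ : ∀ {f g} → (∀ x → f x ≤ g x) → ∑ f ≤ ∑ g
  ∑-mono-≤ {f} {g} f≤g = subst₂ _≤_ (sym (∑≡sum f)) (sym (∑≡sum g)) (sum-mono-≤ (f≤g ∘ elem))

  term≤∑ : ∀ (h : Carrier → ℕ) x → h x ≤ ∑ h
  term≤∑ h x = subst₂ _≤_ (cong h (elem∘toE x)) (sym (∑≡sum h)) (lookup≤sum (h ∘ elem) (toE x))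

  all-≤-or-exceeds : ∀ (h : Carrier → ℕ) c → (∀ x → h x ≤ c) ⊎ ∃ λ x → c < h x
  all-≤-or-exceeds h c with Fin.all? (λ i → h (elem i) ≤? c)
  ... | yes all≤ = inj₁ (λ x → subst (λ y → h y ≤ c) (elem∘toE x) (all≤ (toE x)))
  ... | no ¬all≤ with Fin.¬∀⟶∃¬ q _ (λ i → h (elem i) ≤? c) ¬all≤
  ...   | i , h≰c = inj₂ (elem i , ≰⇒> h≰c)

  _Δ_ : FSubset → FSubset → FSubset
  (A Δ B) x = A x xor B x

  translate : FSubset → Carrier → FSubset
  translate T γ x = T (x +ᶠ γ)

  card-cong : ∀ {A B} → (∀ x → A x ≡ B x) → card A ≡ card B
  card-cong A≗B = ∑-cong (cong 𝟙 ∘ A≗B)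

  card-translate : ∀ T γ → card (translate T γ) ≡ card T
  card-translate T γ = ∑-translate γ (𝟙 ∘ T)

  card-Δ : ∀ A B → 2 * card (A ∩ B) + card (A Δ B) ≡ card A + card B
  card-Δ A B = begin
    2 * card (A ∩ B) + card (A Δ B)                 ≡⟨ cong (_+ card (A Δ B)) (∑-*ˡ 2 (𝟙 ∘ (A ∩ B))) ⟨
    ∑ (λ x → 2 * 𝟙 (A x ∧ B x)) + card (A Δ B)      ≡⟨ ∑-distrib-+ _ _ ⟨
    ∑ (λ x → 2 * 𝟙 (A x ∧ B x) + 𝟙 (A x xor B x))   ≡⟨ ∑-cong (λ x → 𝟙-xor (A x) (B x)) ⟩
    ∑ (λ x → 𝟙 (A x) + 𝟙 (B x))                     ≡⟨ ∑-distrib-+ _ _ ⟩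
    card A + card B                                 ∎
    where open ≡-Reasoning

  ==-translate : ∀ γ x y → (x == y) ≡ ((x +ᶠ γ) == (y +ᶠ γ))
  ==-translate γ x y = begin
    isYes (toE x Fin.≟ toE y)                    ≡⟨ isYes≗does _ ⟩
    does (toE x Fin.≟ toE y)                     ≡⟨ does-⇔ (mk⇔ (cong (toE ∘ (_+ᶠ γ)) ∘ toE-injective)
                                                              (cong toE ∘ +ᶠγ-injective ∘ toE-injective))
                                                      (toE x Fin.≟ toE y) (toE (x +ᶠ γ) Fin.≟ toE (y +ᶠ γ)) ⟩
    does (toE (x +ᶠ γ) Fin.≟ toE (y +ᶠ γ))       ≡⟨ isYes≗does _ ⟨
    isYes (toE (x +ᶠ γ) Fin.≟ toE (y +ᶠ γ))      ∎
    where
    open ≡-Reasoning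
    toE-injective : ∀ {x y} → toE x ≡ toE y → x ≡ y
    toE-injective = Injection.injective (↔⇒↣ enum)
    +ᶠγ-injective : ∀ {x y} → x +ᶠ γ ≡ y +ᶠ γ → x ≡ y
    +ᶠγ-injective = Injection.injective (↔⇒↣ (translation γ))

  affine-translate : ∀ α β S₁ γ x → affine α β S₁ x ≡ affine (α +ᶠ γ) β S₁ (x +ᶠ γ)
  affine-translate α β S₁ γ x = cong or (map-cong (λ s → cong (S₁ s ∧_) (begin
    x == (α +ᶠ β *ᶠ s)                     ≡⟨ ==-translate γ x _ ⟩
    (x +ᶠ γ) == (α +ᶠ β *ᶠ s +ᶠ γ)         ≡⟨ cong ((x +ᶠ γ) ==_) (+-shuffle α (β *ᶠ s)) ⟩
    (x +ᶠ γ) == (α +ᶠ γ +ᶠ β *ᶠ s)         ∎)) elements)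
    where
    open ≡-Reasoning
    +-shuffle : ∀ a b → a +ᶠ b +ᶠ γ ≡ a +ᶠ γ +ᶠ b
    +-shuffle a b = trans (+ᶠ-assoc a b γ) (trans (cong (a +ᶠ_) (+ᶠ-comm b γ)) (sym (+ᶠ-assoc a γ b)))

  module _ (S S₁ : FSubset) where

    parity-translate : ∀ T γ → ParityCondition S T S₁ → ParityCondition S (translate T γ) S₁
    parity-translate T γ even α β β∈S = subst Even (sym (begin
      card (translate T γ ∩ affine α β S₁)                  ≡⟨ card-cong (λ x → cong (T (x +ᶠ γ) ∧_) (affine-translate α β S₁ γ x)) ⟩
      card (translate (T ∩ affine (α +ᶠ γ) β S₁) γ)          ≡⟨ card-translate _ γ ⟩
      card (T ∩ affine (α +ᶠ γ) β S₁)                       ∎)) (even (α +ᶠ γ) β β∈S)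
      where open ≡-Reasoning

    parity-Δ : ∀ A B → ParityCondition S A S₁ → ParityCondition S B S₁ → ParityCondition S (A Δ B) S₁
    parity-Δ A B evenA evenB α β β∈S = ∣m+n∣m⇒∣n (subst Even counted (∣m∣n⇒∣m+n (evenA α β β∈S) (evenB α β β∈S)))
                                                 (m∣m*n (card ((A ∩ L) ∩ (B ∩ L))))
      where
      L = affine α β S₁
      counted : card (A ∩ L) + card (B ∩ L) ≡ 2 * card ((A ∩ L) ∩ (B ∩ L)) + card ((A Δ B) ∩ L)
      counted = trans (sym (card-Δ (A ∩ L) (B ∩ L)))
                      (cong (2 * card ((A ∩ L) ∩ (B ∩ L)) +_) (card-cong (λ x → sym (∧-distribʳ-xor (L x) (A x) (B x)))))

  ∑-card-∩-translate : ∀ T → ∑ (λ γ → card (T ∩ translate T γ)) ≡ card T * card T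
  ∑-card-∩-translate T = begin
    ∑ (λ γ → ∑ (λ x → 𝟙 (T x ∧ T (x +ᶠ γ))))    ≡⟨ ∑-comm (λ γ x → 𝟙 (T x ∧ T (x +ᶠ γ))) ⟩
    ∑ (λ x → ∑ (λ γ → 𝟙 (T x ∧ T (x +ᶠ γ))))    ≡⟨ ∑-cong (λ x → trans (∑-cong (λ γ → 𝟙-∧ (T x) (T (x +ᶠ γ)))) (∑-*ˡ (𝟙 (T x)) _)) ⟩
    ∑ (λ x → 𝟙 (T x) * ∑ (λ γ → 𝟙 (T (x +ᶠ γ)))) ≡⟨ ∑-cong (λ x → cong (𝟙 (T x) *_) (orbit x)) ⟩
    ∑ (λ x → 𝟙 (T x) * card T)                  ≡⟨ ∑-cong (λ x → *-comm (𝟙 (T x)) (card T)) ⟩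
    ∑ (λ x → card T * 𝟙 (T x))                  ≡⟨ ∑-*ˡ (card T) (𝟙 ∘ T) ⟩
    card T * card T                             ∎
    where
    open ≡-Reasoning
    orbit : ∀ x → ∑ (λ γ → 𝟙 (T (x +ᶠ γ))) ≡ card T
    orbit x = trans (∑-cong (λ γ → cong (𝟙 ∘ T) (+ᶠ-comm x γ))) (∑-translate x (𝟙 ∘ T))

  ∑-card-Δ-translate : ∀ T → 2 * (card T * card T) + ∑ (λ γ → card (T Δ translate T γ)) ≡ q * (card T + card T)
  ∑-card-Δ-translate T = begin
    2 * (card T * card T) + ∑ (λ γ → card (T Δ translate T γ))
      ≡⟨ cong (λ s → 2 * s + ∑ (λ γ → card (T Δ translate T γ))) (∑-card-∩-translate T) ⟨
    2 * ∑ (λ γ → card (T ∩ translate T γ)) + ∑ (λ γ → card (T Δ translate T γ))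
      ≡⟨ cong (_+ ∑ (λ γ → card (T Δ translate T γ))) (∑-*ˡ 2 _) ⟨
    ∑ (λ γ → 2 * card (T ∩ translate T γ)) + ∑ (λ γ → card (T Δ translate T γ))
      ≡⟨ ∑-distrib-+ _ _ ⟨
    ∑ (λ γ → 2 * card (T ∩ translate T γ) + card (T Δ translate T γ))
      ≡⟨ ∑-cong (λ γ → trans (card-Δ T (translate T γ)) (cong (card T +_) (card-translate T γ))) ⟩
    ∑ (λ _ → card T + card T)
      ≡⟨ ∑-const (card T + card T) ⟩
    q * (card T + card T) ∎
    where open ≡-Reasoning

  half-or-Δ-translate-larger : ∀ T → 0 < card T →
    q ≤ card T + card T ⊎ ∃ λ γ → card T < card (T Δ translate T γ)
  half-or-Δ-translate-larger T 0<t with all-≤-or-exceeds (λ γ → card (T Δ translate T γ)) (card T)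
  ... | inj₂ larger = inj₂ larger
  ... | inj₁ all≤  = inj₁ (averaging q (card T) (∑ (λ γ → card (T Δ translate T γ))) {{>-nonZero 0<t}}
        (subst (∑ (λ γ → card (T Δ translate T γ)) ≤_) (∑-const (card T)) (∑-mono-≤ all≤)) (∑-card-Δ-translate T))

  0<card : ∀ A → Nonempty A → 0 < card A
  0<card A (x , Ax) = ≤-trans (≤-reflexive (cong 𝟙 (sym Ax))) (term≤∑ (𝟙 ∘ A) x)

  large-parity-set : ∀ S S₁ n T → 0 < card T → ParityCondition S T S₁ → q ≤ n + card T →
    Σ FSubset λ T' → ⌈ q /2⌉ ≤ card T' × ParityCondition S T' S₁
  large-parity-set S S₁ zero T _ even q≤t = T , ≤-trans (⌈n/2⌉≤n q) q≤t , even
  large-parity-set S S₁ (suc n) T 0<t even q≤n+t with half-or-Δ-translate-larger T 0<t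
  ... | inj₁ q≤2t = T , subst (⌈ q /2⌉ ≤_) (sym (n≡⌈n+n/2⌉ (card T))) (⌈n/2⌉-mono q≤2t) , even
  ... | inj₂ (γ , t<t') =
    large-parity-set S S₁ n (T Δ translate T γ) (<-trans 0<t t<t')
      (parity-Δ S S₁ T _ even (parity-translate S S₁ T γ even))
      (≤-trans q≤n+t (≤-trans (≤-reflexive (sym (+-suc n (card T)))) (+-monoʳ-≤ n t<t')))

lemma4 : (F : FiniteField) → let open FiniteField F in
    (k : ℕ) (S : FSubset) → SubsetOfUnits S →
    (k' : ℕ) (S₀ S₁ : FSubset) → NiceWitness k S k' S₀ S₁ →
    Σ FSubset λ S₀' → ⌈ q /2⌉ ≤ card S₀' × ParityCondition S S₀' S₁
lemma4 F k S _ k' S₀ S₁ (_ , _ , _ , nonempty , _ , even) =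
  large-parity-set S S₁ q S₀ (0<card S₀ nonempty) even (m≤m+n q (card S₀))
  where
  open FiniteField F
  open ParitySets F
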